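{- Let $n \geq 3$ be an integer and let $G$ be a finite simple graph (undirected, no loops, no multiple edges) with at least one and at most $n(n-1)/2$ edges. Then each edge of $G$ is contained, on average, in at most $n-2$ triangles, i.e. $\frac{1}{|E(G)|}\sum_{e \in E(G)} t(e) \leq n-2$, where $t(e)$ is the number of triangles of $G$ containing the edge $e$. Equality holds only for the complete graph $K_n$.
   Context: A triangle of $G$ is a set of three pairwise adjacent vertices; it contains the three edges joining them. -}

module Defs where

open import Data.Nat using (ℕ; zero; suc; _+_; _*_; _<ᵇ_)
open import Data.Bool using (Bool; true; false; _∧_; if_then_else_)
open import Data.Fin using (Fin; toℕ; zero; suc)
open import Relation.Binary.PropositionalEquality using (_≡_)

record SimpleGraph (v : ℕ) : Set where
  field
    adj    : Fin v → Fin v → Bool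
    sym    : ∀ i j → adj i j ≡ adj j i
    irrefl : ∀ i → adj i i ≡ false
open SimpleGraph public

sumFin : ∀ {v} → (Fin v → ℕ) → ℕ
sumFin {zero}  f = 0
sumFin {suc v} f = f zero + sumFin (λ i → f (suc i))

b2n : Bool → ℕ
b2n true  = 1
b2n false = 0

-- Each edge {i,j} is represented once, by the ordered pair with toℕ i < toℕ j.
isEdge : ∀ {v} → SimpleGraph v → Fin v → Fin v → Bool
isEdge G i j = (toℕ i <ᵇ toℕ j) ∧ adj G i j

numEdges : ∀ {v} → SimpleGraph v → ℕ
numEdges G = sumFin (λ i → sumFin (λ j → b2n (isEdge G i j)))

-- t(e) for e = {i,j}: number of triangles {i,j,w} of G containing e,
-- i.e. number of vertices w adjacent to both i and j.
t : ∀ {v} → SimpleGraph v → Fin v → Fin v → ℕ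
t G i j = sumFin (λ w → b2n (adj G i w ∧ adj G j w))

sumT : ∀ {v} → SimpleGraph v → ℕ
sumT G = sumFin (λ i → sumFin (λ j → if isEdge G i j then t G i j else 0))

{-# OPTIONS --safe #-}
-- Write d(i) for the degree of i and tAt(i) = Σ_{j ∼ i} t(i,j), so that
-- Σ_i tAt(i) = 2 Σ_e t(e) and Σ_i d(i) = 2|E| ≤ n(n-1). Two local bounds hold at
-- every vertex i:
--   tAt(i) + d(i) ≤ d(i)², since for a neighbour j the common neighbours of i and j,
--   together with j, are neighbours of i;
--   tAt(i) + 2d(i) ≤ 2|E|, since the ordered edges inside N(i) and the 2d(i) ordered
--   edges at i are distinct.
-- The first gives tAt(i) ≤ (n-2) d(i) when d(i) ≤ n-1, the second when d(i) ≥ n-1;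
-- summing over i proves the inequality. In case of equality tAt(i) = (n-2) d(i)
-- everywhere, and at a vertex i of positive degree this forces d(i) = n-1 with both
-- bounds tight: N(i) is a clique and every edge has both ends in N(i) ∪ {i}.
module Submission where

open import Defs
open import Data.Nat using (ℕ; _≤_; _*_; _∸_)
open import Data.Fin using (Fin)
open import Data.Fin.Subset using (Subset; _∈_; ∣_∣)
open import Data.Product using (Σ; _×_)
open import Data.Bool using (true)
open import Relation.Binary.PropositionalEquality using (_≡_; _≢_)

open import Data.Bool using (Bool; false; _∧_; _∨_; if_then_else_)
open import Data.Bool.Properties using (∧-comm; ∧-zeroʳ; ∨-zeroʳ)
open import Data.Fin using (zero; suc; toℕ)
open import Data.Fin.Properties using (_≟_; toℕ-injective)
open import Data.Nat using (zero; suc; _+_; _<_; _<?_; _≤?_; z≤n; s≤s; z<s)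
open import Data.Nat.Properties hiding (_≟_)
open import Algebra.Properties.Semiring.Sum +-*-semiring
  using (sum; ∑-distrib-+; ∑-comm; *-distribˡ-sum; *-distribʳ-sum)
open import Data.Nat.Tactic.RingSolver using (solve-∀)
open import Algebra.Properties.CommutativeSemigroup *-commutativeSemigroup using (x∙yz≈y∙xz)
open import Data.Product using (∃; _,_; proj₁; proj₂; map)
open import Data.Sum using (_⊎_; inj₁; inj₂)
open import Data.Vec using (tabulate)
open import Data.Vec.Properties using (lookup∘tabulate; lookup⇒[]=; []=⇒lookup)
open import Function using (_∘_; id)
open import Relation.Binary.Definitions using (tri<; tri≈; tri>)
open import Relation.Binary.PropositionalEquality as ≡
  using (refl; trans; cong; cong₂; subst; _≗_; module ≡-Reasoning)
open import Relation.Nullary using (¬_; yes; no; does; contradiction)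
open import Relation.Nullary.Decidable using (dec-true; dec-false)

sumFin≡sum : ∀ {v} (f : Fin v → ℕ) → sumFin f ≡ sum f
sumFin≡sum {zero}  f = refl
sumFin≡sum {suc v} f = cong (f zero +_) (sumFin≡sum (f ∘ suc))

sumFin-cong : ∀ {v} {f g : Fin v → ℕ} → f ≗ g → sumFin f ≡ sumFin g
sumFin-cong {zero}  f≗g = refl
sumFin-cong {suc v} f≗g = cong₂ _+_ (f≗g zero) (sumFin-cong (f≗g ∘ suc))

sumFin-distrib-+ : ∀ {v} (f g : Fin v → ℕ) →
                   sumFin (λ i → f i + g i) ≡ sumFin f + sumFin g
sumFin-distrib-+ f g = begin
  sumFin (λ i → f i + g i) ≡⟨ sumFin≡sum (λ i → f i + g i) ⟩
  sum (λ i → f i + g i)    ≡⟨ ∑-distrib-+ f g ⟩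
  sum f + sum g            ≡⟨ cong₂ _+_ (sumFin≡sum f) (sumFin≡sum g) ⟨
  sumFin f + sumFin g      ∎
  where open ≡-Reasoning

sumFin-*ˡ : ∀ {v} c (f : Fin v → ℕ) → sumFin (λ i → c * f i) ≡ c * sumFin f
sumFin-*ˡ c f = begin
  sumFin (λ i → c * f i) ≡⟨ sumFin≡sum (λ i → c * f i) ⟩
  sum (λ i → c * f i)    ≡⟨ *-distribˡ-sum c f ⟨
  c * sum f              ≡⟨ cong (c *_) (sumFin≡sum f) ⟨
  c * sumFin f           ∎
  where open ≡-Reasoning

sumFin-*ʳ : ∀ {v} (f : Fin v → ℕ) c → sumFin (λ i → f i * c) ≡ sumFin f * c
sumFin-*ʳ f c = begin
  sumFin (λ i → f i * c) ≡⟨ sumFin≡sum (λ i → f i * c) ⟩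
  sum (λ i → f i * c)    ≡⟨ *-distribʳ-sum c f ⟨
  sum f * c              ≡⟨ cong (_* c) (sumFin≡sum f) ⟨
  sumFin f * c           ∎
  where open ≡-Reasoning

sumFin-comm : ∀ {u v} (f : Fin u → Fin v → ℕ) →
              sumFin (λ i → sumFin (f i)) ≡ sumFin (λ j → sumFin (λ i → f i j))
sumFin-comm f = begin
  sumFin (λ i → sumFin (f i))        ≡⟨ sumFin-cong (λ i → sumFin≡sum (f i)) ⟩
  sumFin (λ i → sum (f i))           ≡⟨ sumFin≡sum (λ i → sum (f i)) ⟩
  sum (λ i → sum (f i))              ≡⟨ ∑-comm f ⟩
  sum (λ j → sum (λ i → f i j))      ≡⟨ sumFin≡sum (λ j → sum (λ i → f i j)) ⟨
  sumFin (λ j → sum (λ i → f i j))   ≡⟨ sumFin-cong (λ j → sumFin≡sum (λ i → f i j)) ⟨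
  sumFin (λ j → sumFin (λ i → f i j)) ∎
  where open ≡-Reasoning

sumFin-mono-≤ : ∀ {v} {f g : Fin v → ℕ} → (∀ i → f i ≤ g i) → sumFin f ≤ sumFin g
sumFin-mono-≤ {zero}  f≤g = z≤n
sumFin-mono-≤ {suc v} f≤g = +-mono-≤ (f≤g zero) (sumFin-mono-≤ (f≤g ∘ suc))

+-mono-≤-≡⇒≡ : ∀ {a b c d} → a ≤ b → c ≤ d → a + c ≡ b + d → a ≡ b × c ≡ d
+-mono-≤-≡⇒≡ {a} {b} {c} {d} a≤b c≤d eq = ≤-antisym a≤b b≤a , ≤-antisym c≤d d≤c
  where
  open ≤-Reasoning
  b≤a : b ≤ a
  b≤a = +-cancelʳ-≤ d b a (begin b + d ≡⟨ eq ⟨ a + c ≤⟨ +-monoʳ-≤ a c≤d ⟩ a + d ∎)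
  d≤c : d ≤ c
  d≤c = +-cancelˡ-≤ b d c (begin b + d ≡⟨ eq ⟨ a + c ≤⟨ +-monoˡ-≤ c a≤b ⟩ b + c ∎)

sumFin-≡⇒pointwise-≡ : ∀ {v} {f g : Fin v → ℕ} →
                       (∀ i → f i ≤ g i) → sumFin f ≡ sumFin g → f ≗ g
sumFin-≡⇒pointwise-≡ {suc v} {f} {g} f≤g eq = pointwise
  where
  split : f zero ≡ g zero × sumFin (f ∘ suc) ≡ sumFin (g ∘ suc)
  split = +-mono-≤-≡⇒≡ (f≤g zero) (sumFin-mono-≤ (f≤g ∘ suc)) eq
  pointwise : f ≗ g
  pointwise zero    = proj₁ split
  pointwise (suc i) = sumFin-≡⇒pointwise-≡ (f≤g ∘ suc) (proj₂ split) i

sumFin-positive : ∀ {v} (f : Fin v → ℕ) → 0 < sumFin f → ∃ λ i → 0 < f i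
sumFin-positive {suc v} f pos with f zero in eq
... | suc _ = zero , subst (0 <_) (≡.sym eq) z<s
... | zero  = map suc id (sumFin-positive (f ∘ suc) pos)

δ : ∀ {v} → Fin v → Fin v → ℕ
δ i j = b2n (does (i ≟ j))

δ-≢ : ∀ {v} {i j : Fin v} → i ≢ j → δ i j ≡ 0
δ-≢ {i = i} {j} i≢j = cong b2n (dec-false (i ≟ j) i≢j)

sumFin-δ* : ∀ {v} (i : Fin v) (f : Fin v → ℕ) → sumFin (λ j → δ i j * f j) ≡ f i
sumFin-δ* {suc v} zero f =
  trans (cong₂ _+_ (*-identityˡ (f zero)) (sumFin-*ˡ 0 (f ∘ suc))) (+-identityʳ (f zero))
sumFin-δ* {suc v} (suc i) f = sumFin-δ* i (f ∘ suc)

sumFin-δ : ∀ {v} (i : Fin v) → sumFin (δ i) ≡ 1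
sumFin-δ i = trans (sumFin-cong (λ j → ≡.sym (*-identityʳ (δ i j)))) (sumFin-δ* i (λ _ → 1))

b2n-injective : ∀ {a b} → b2n a ≡ b2n b → a ≡ b
b2n-injective {true}  {true}  _ = refl
b2n-injective {false} {false} _ = refl

b2n≡if : ∀ b → b2n b ≡ (if b then 1 else 0)
b2n≡if true  = refl
b2n≡if false = refl

b2n*≡if : ∀ b x → b2n b * x ≡ (if b then x else 0)
b2n*≡if true  x = +-identityʳ x
b2n*≡if false x = refl

b2n-∧-≤ˡ : ∀ a b → b2n (a ∧ b) ≤ b2n a
b2n-∧-≤ˡ true  true  = ≤-refl
b2n-∧-≤ˡ true  false = z≤n
b2n-∧-≤ˡ false b     = z≤n

b2n-∧-≤ʳ : ∀ a b → b2n (a ∧ b) ≤ b2n b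
b2n-∧-≤ʳ true  b = ≤-refl
b2n-∧-≤ʳ false b = z≤n

b2n-*-≤ : ∀ a x → b2n a * x ≤ x
b2n-*-≤ true  x = ≤-reflexive (+-identityʳ x)
b2n-*-≤ false x = z≤n

b2n-*-positive : ∀ a {x} → 0 < b2n a * x → a ≡ true
b2n-*-positive true _ = refl

b2n-*-monoʳ-≤ : ∀ a {x y} → (a ≡ true → x ≤ y) → b2n a * x ≤ b2n a * y
b2n-*-monoʳ-≤ true  x≤y = *-monoʳ-≤ 1 (x≤y refl)
b2n-*-monoʳ-≤ false x≤y = z≤n

b2n-*-cancelˡ-≡ : ∀ {a x y} → a ≡ true → b2n a * x ≡ b2n a * y → x ≡ y
b2n-*-cancelˡ-≡ {x = x} {y} refl eq = *-cancelˡ-≡ x y 1 eq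

[2+c]*d≡c*d+d+d : ∀ c d → suc (suc c) * d ≡ c * d + d + d
[2+c]*d≡c*d+d+d = solve-∀

localBound : ∀ {x d s} c → x + d ≤ d * d → x + d + d ≤ s → s ≤ suc (suc c) * suc c →
             x ≤ c * d
localBound {x} {d} {s} c h₁ h₂ h₃ with d ≤? suc c
... | yes d≤c+1 = +-cancelʳ-≤ d x (c * d) (begin
  x + d         ≤⟨ h₁ ⟩
  d * d         ≤⟨ *-monoˡ-≤ d d≤c+1 ⟩
  suc c * d     ≡⟨ +-comm d (c * d) ⟩
  c * d + d     ∎)
  where open ≤-Reasoning
... | no d≰c+1 = +-cancelʳ-≤ d x (c * d) (+-cancelʳ-≤ d (x + d) (c * d + d) (begin
  x + d + d               ≤⟨ h₂ ⟩
  s                       ≤⟨ h₃ ⟩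
  suc (suc c) * suc c     ≤⟨ *-monoʳ-≤ (suc (suc c)) (<⇒≤ (≰⇒> d≰c+1)) ⟩
  suc (suc c) * d         ≡⟨ [2+c]*d≡c*d+d+d c d ⟩
  c * d + d + d           ∎))
  where open ≤-Reasoning

localBound-tight : ∀ {x d s} c → x ≡ c * d → 0 < d →
                   x + d ≤ d * d → x + d + d ≤ s → s ≤ suc (suc c) * suc c →
                   d ≡ suc c × x + d ≡ d * d × x + d + d ≡ s
localBound-tight {d = d@(suc _)} {s} c refl _ h₁ h₂ h₃ = d≡c+1 , tight₁ , tight₂
  where
  open ≤-Reasoning
  c+1≤d : suc c ≤ d
  c+1≤d = *-cancelʳ-≤ (suc c) d d (begin
    suc c * d ≡⟨ +-comm d (c * d) ⟩
    c * d + d ≤⟨ h₁ ⟩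
    d * d     ∎)
  d≤c+1 : d ≤ suc c
  d≤c+1 = *-cancelˡ-≤ (suc (suc c)) (begin
    suc (suc c) * d     ≡⟨ [2+c]*d≡c*d+d+d c d ⟩
    c * d + d + d       ≤⟨ h₂ ⟩
    s                   ≤⟨ h₃ ⟩
    suc (suc c) * suc c ∎)
  d≡c+1 : d ≡ suc c
  d≡c+1 = ≤-antisym d≤c+1 c+1≤d
  tight₁ : c * d + d ≡ d * d
  tight₁ = trans (+-comm (c * d) d) (cong (_* d) (≡.sym d≡c+1))
  tight₂ : c * d + d + d ≡ s
  tight₂ = ≤-antisym h₂ (begin
    s                   ≤⟨ h₃ ⟩
    suc (suc c) * suc c ≡⟨ cong (suc (suc c) *_) d≡c+1 ⟨
    suc (suc c) * d     ≡⟨ [2+c]*d≡c*d+d+d c d ⟩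
    c * d + d + d       ∎)

∣tabulate∣ : ∀ {v} (f : Fin v → Bool) → ∣ tabulate f ∣ ≡ sumFin (b2n ∘ f)
∣tabulate∣ {zero}  f = refl
∣tabulate∣ {suc v} f with f zero
... | true  = cong suc (∣tabulate∣ (f ∘ suc))
... | false = ∣tabulate∣ (f ∘ suc)

module _ {v : ℕ} (G : SimpleGraph v) where

  A : Fin v → Fin v → ℕ
  A i j = b2n (adj G i j)

  deg : Fin v → ℕ
  deg i = sumFin (A i)

  common : Fin v → Fin v → Fin v → ℕ
  common i j w = b2n (adj G i w ∧ adj G j w)

  tAt : Fin v → ℕ
  tAt i = sumFin (λ j → A i j * t G i j)

  adj-sym : ∀ {i j} → adj G i j ≡ true → adj G j i ≡ true
  adj-sym {i} {j} = trans (sym G j i)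

  t-sym : ∀ i j → t G i j ≡ t G j i
  t-sym i j = sumFin-cong (λ w → cong b2n (∧-comm (adj G i w) (adj G j w)))

  onEdge : (Fin v → Fin v → ℕ) → Fin v → Fin v → ℕ
  onEdge F i j = if isEdge G i j then F i j else 0

  edgeSum : (Fin v → Fin v → ℕ) → ℕ
  edgeSum F = sumFin (λ i → sumFin (onEdge F i))

  -- `does (m <? n)` computes to `m <ᵇ n`.
  isEdge-< : ∀ {i j} → toℕ i < toℕ j → isEdge G i j ≡ adj G i j
  isEdge-< {i} {j} i<j = cong (_∧ adj G i j) (dec-true (toℕ i <? toℕ j) i<j)

  isEdge-≮ : ∀ {i j} → ¬ toℕ i < toℕ j → isEdge G i j ≡ false
  isEdge-≮ {i} {j} i≮j = cong (_∧ adj G i j) (dec-false (toℕ i <? toℕ j) i≮j)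

  A*≡onEdge+onEdgeᵀ : ∀ F → (∀ i j → F i j ≡ F j i) → ∀ i j →
                      A i j * F i j ≡ onEdge F i j + onEdge F j i
  A*≡onEdge+onEdgeᵀ F F-sym i j with <-cmp (toℕ i) (toℕ j)
  ... | tri< i<j _ j≮i rewrite isEdge-< i<j | isEdge-≮ j≮i =
    trans (b2n*≡if (adj G i j) (F i j)) (≡.sym (+-identityʳ _))
  ... | tri≈ _ i≡j _ rewrite toℕ-injective i≡j | isEdge-≮ (<-irrefl {toℕ j} refl) | irrefl G j =
    refl
  ... | tri> i≮j _ j<i rewrite isEdge-< j<i | isEdge-≮ i≮j | sym G i j | F-sym i j =
    b2n*≡if (adj G j i) (F j i)

  sumFin²-A*≡2*edgeSum : ∀ F → (∀ i j → F i j ≡ F j i) →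
                         sumFin (λ i → sumFin (λ j → A i j * F i j)) ≡ 2 * edgeSum F
  sumFin²-A*≡2*edgeSum F F-sym = begin
    sumFin (λ i → sumFin (λ j → A i j * F i j))
      ≡⟨ sumFin-cong (λ i → sumFin-cong (A*≡onEdge+onEdgeᵀ F F-sym i)) ⟩
    sumFin (λ i → sumFin (λ j → E i j + E j i))
      ≡⟨ sumFin-cong (λ i → sumFin-distrib-+ (E i) (λ j → E j i)) ⟩
    sumFin (λ i → sumFin (E i) + sumFin (λ j → E j i))
      ≡⟨ sumFin-distrib-+ (λ i → sumFin (E i)) (λ i → sumFin (λ j → E j i)) ⟩
    edgeSum F + sumFin (λ i → sumFin (λ j → E j i))
      ≡⟨ cong (edgeSum F +_) (sumFin-comm (λ i j → E j i)) ⟩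
    edgeSum F + edgeSum F
      ≡⟨ cong (edgeSum F +_) (+-identityʳ (edgeSum F)) ⟨
    2 * edgeSum F
      ∎
    where
    open ≡-Reasoning
    E : Fin v → Fin v → ℕ
    E = onEdge F

  handshake : 2 * numEdges G ≡ sumFin deg
  handshake = begin
    2 * numEdges G
      ≡⟨ cong (2 *_) (sumFin-cong (λ i → sumFin-cong (λ j → b2n≡if (isEdge G i j)))) ⟩
    2 * edgeSum (λ _ _ → 1)
      ≡⟨ sumFin²-A*≡2*edgeSum (λ _ _ → 1) (λ _ _ → refl) ⟨
    sumFin (λ i → sumFin (λ j → A i j * 1))
      ≡⟨ sumFin-cong (λ i → sumFin-cong (λ j → *-identityʳ (A i j))) ⟩
    sumFin deg
      ∎
    where open ≡-Reasoning

  sumT-double : 2 * sumT G ≡ sumFin tAt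
  sumT-double = ≡.sym (sumFin²-A*≡2*edgeSum (t G) t-sym)

  common+δ≤A : ∀ {i j} → adj G i j ≡ true → ∀ w → common i j w + δ j w ≤ A i w
  common+δ≤A {i} {j} i~j w with j ≟ w
  ... | yes refl rewrite irrefl G j | ∧-zeroʳ (adj G i j) | i~j = ≤-refl
  ... | no _     = ≤-trans (≤-reflexive (+-identityʳ _)) (b2n-∧-≤ˡ (adj G i w) (adj G j w))

  t+1≡sumFin : ∀ i j → t G i j + 1 ≡ sumFin (λ w → common i j w + δ j w)
  t+1≡sumFin i j =
    trans (cong (t G i j +_) (≡.sym (sumFin-δ j))) (≡.sym (sumFin-distrib-+ (common i j) (δ j)))

  t+1≤deg : ∀ {i j} → adj G i j ≡ true → t G i j + 1 ≤ deg i
  t+1≤deg {i} {j} i~j =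
    subst (_≤ deg i) (≡.sym (t+1≡sumFin i j)) (sumFin-mono-≤ (common+δ≤A i~j))

  t+1≡deg⇒adj : ∀ {i j w} → adj G i j ≡ true → t G i j + 1 ≡ deg i →
                j ≢ w → adj G i w ≡ true → adj G j w ≡ true
  t+1≡deg⇒adj {i} {j} {w} i~j eq j≢w i~w = b2n-injective (begin
    b2n (adj G j w)        ≡⟨ cong (λ b → b2n (b ∧ adj G j w)) i~w ⟨
    common i j w           ≡⟨ +-identityʳ _ ⟨
    common i j w + 0       ≡⟨ cong (common i j w +_) (δ-≢ j≢w) ⟨
    common i j w + δ j w   ≡⟨ tight w ⟩
    A i w                  ≡⟨ cong b2n i~w ⟩
    b2n true               ∎)
    where
    open ≡-Reasoning
    tight : ∀ w → common i j w + δ j w ≡ A i w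
    tight = sumFin-≡⇒pointwise-≡ (common+δ≤A i~j) (trans (≡.sym (t+1≡sumFin i j)) eq)

  tAt+deg≡sumFin : ∀ i → sumFin (λ j → A i j * (t G i j + 1)) ≡ tAt i + deg i
  tAt+deg≡sumFin i = begin
    sumFin (λ j → A i j * (t G i j + 1))
      ≡⟨ sumFin-cong (λ j → *-distribˡ-+ (A i j) (t G i j) 1) ⟩
    sumFin (λ j → A i j * t G i j + A i j * 1)
      ≡⟨ sumFin-distrib-+ (λ j → A i j * t G i j) (λ j → A i j * 1) ⟩
    tAt i + sumFin (λ j → A i j * 1)
      ≡⟨ cong (tAt i +_) (sumFin-cong (λ j → *-identityʳ (A i j))) ⟩
    tAt i + deg i
      ∎
    where open ≡-Reasoning

  A*[t+1]≤A*deg : ∀ i j → A i j * (t G i j + 1) ≤ A i j * deg i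
  A*[t+1]≤A*deg i j = b2n-*-monoʳ-≤ (adj G i j) t+1≤deg

  tAt+deg≤deg*deg : ∀ i → tAt i + deg i ≤ deg i * deg i
  tAt+deg≤deg*deg i = begin
    tAt i + deg i                        ≡⟨ tAt+deg≡sumFin i ⟨
    sumFin (λ j → A i j * (t G i j + 1)) ≤⟨ sumFin-mono-≤ (A*[t+1]≤A*deg i) ⟩
    sumFin (λ j → A i j * deg i)         ≡⟨ sumFin-*ʳ (A i) (deg i) ⟩
    deg i * deg i                        ∎
    where open ≤-Reasoning

  tAt+deg≡deg*deg⇒adj : ∀ {i j w} → tAt i + deg i ≡ deg i * deg i →
                        adj G i j ≡ true → adj G i w ≡ true → j ≢ w → adj G j w ≡ true
  tAt+deg≡deg*deg⇒adj {i} {j} eq i~j i~w j≢w = t+1≡deg⇒adj i~j t+1≡deg j≢w i~w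
    where
    sums≡ : sumFin (λ j → A i j * (t G i j + 1)) ≡ sumFin (λ j → A i j * deg i)
    sums≡ = trans (tAt+deg≡sumFin i) (trans eq (≡.sym (sumFin-*ʳ (A i) (deg i))))
    t+1≡deg : t G i j + 1 ≡ deg i
    t+1≡deg = b2n-*-cancelˡ-≡ i~j (sumFin-≡⇒pointwise-≡ (A*[t+1]≤A*deg i) sums≡ j)

  -- Counts the ordered edge (j, w) if it lies inside N(i), leaves i, or enters i.
  localEdge : Fin v → Fin v → Fin v → ℕ
  localEdge i j w = A i j * common i j w + δ i j * A j w + δ i w * A j w

  localEdge≤A : ∀ i j w → localEdge i j w ≤ A j w
  localEdge≤A i j w with i ≟ j | i ≟ w
  ... | yes refl | yes refl rewrite irrefl G i = z≤n
  ... | yes refl | no _     rewrite irrefl G i = ≤-reflexive (trans (+-identityʳ _) (+-identityʳ _))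
  ... | no _     | yes refl rewrite irrefl G i | *-zeroʳ (A i j) = ≤-reflexive (+-identityʳ _)
  ... | no _     | no _     = begin
    A i j * common i j w + 0 + 0 ≡⟨ trans (+-identityʳ _) (+-identityʳ _) ⟩
    A i j * common i j w         ≤⟨ b2n-*-≤ (adj G i j) _ ⟩
    common i j w                 ≤⟨ b2n-∧-≤ʳ (adj G i w) (adj G j w) ⟩
    A j w                        ∎
    where open ≤-Reasoning

  sumFin-localEdge : ∀ i j → sumFin (localEdge i j) ≡ A i j * t G i j + δ i j * deg j + A j i
  sumFin-localEdge i j = begin
    sumFin (localEdge i j)
      ≡⟨ sumFin-distrib-+ (λ w → X w + Y w) (λ w → δ i w * A j w) ⟩
    sumFin (λ w → X w + Y w) + sumFin (λ w → δ i w * A j w)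
      ≡⟨ cong₂ _+_ (sumFin-distrib-+ X Y) (sumFin-δ* i (A j)) ⟩
    sumFin X + sumFin Y + A j i
      ≡⟨ cong₂ (λ a b → a + b + A j i) (sumFin-*ˡ (A i j) (common i j))
                                       (sumFin-*ˡ (δ i j) (A j)) ⟩
    A i j * t G i j + δ i j * deg j + A j i
      ∎
    where
    open ≡-Reasoning
    X Y : Fin v → ℕ
    X w = A i j * common i j w
    Y w = δ i j * A j w

  sumFin²-localEdge : ∀ i → sumFin (λ j → sumFin (localEdge i j)) ≡ tAt i + deg i + deg i
  sumFin²-localEdge i = begin
    sumFin (λ j → sumFin (localEdge i j))
      ≡⟨ sumFin-cong (sumFin-localEdge i) ⟩
    sumFin (λ j → A i j * t G i j + δ i j * deg j + A j i)
      ≡⟨ sumFin-distrib-+ (λ j → A i j * t G i j + δ i j * deg j) (λ j → A j i) ⟩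
    sumFin (λ j → A i j * t G i j + δ i j * deg j) + sumFin (λ j → A j i)
      ≡⟨ cong₂ _+_ (sumFin-distrib-+ (λ j → A i j * t G i j) (λ j → δ i j * deg j))
                   (sumFin-cong (λ j → cong b2n (sym G j i))) ⟩
    tAt i + sumFin (λ j → δ i j * deg j) + deg i
      ≡⟨ cong (λ s → tAt i + s + deg i) (sumFin-δ* i deg) ⟩
    tAt i + deg i + deg i
      ∎
    where open ≡-Reasoning

  sumFin-localEdge≤deg : ∀ i j → sumFin (localEdge i j) ≤ deg j
  sumFin-localEdge≤deg i j = sumFin-mono-≤ (localEdge≤A i j)

  tAt+deg+deg≤sumFin-deg : ∀ i → tAt i + deg i + deg i ≤ sumFin deg
  tAt+deg+deg≤sumFin-deg i =
    subst (_≤ sumFin deg) (sumFin²-localEdge i) (sumFin-mono-≤ (sumFin-localEdge≤deg i))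

  tAt+deg+deg≡sumFin-deg⇒adj : ∀ {i j w} → tAt i + deg i + deg i ≡ sumFin deg →
                               adj G j w ≡ true → i ≢ j → i ≢ w → adj G i j ≡ true
  tAt+deg+deg≡sumFin-deg⇒adj {i} {j} {w} eq j~w i≢j i≢w = b2n-*-positive (adj G i j) (begin-strict
    0                                <⟨ z<s ⟩
    b2n true                         ≡⟨ cong b2n j~w ⟨
    A j w                            ≡⟨ localEdge≡A ⟨
    localEdge i j w                  ≡⟨ cong₂ (λ a b → A i j * common i j w + a * A j w + b * A j w)
                                              (δ-≢ i≢j) (δ-≢ i≢w) ⟩
    A i j * common i j w + 0 + 0     ≡⟨ trans (+-identityʳ _) (+-identityʳ _) ⟩
    A i j * common i j w             ∎)
    where
    open ≤-Reasoning
    localEdge≡A : localEdge i j w ≡ A j w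
    localEdge≡A = sumFin-≡⇒pointwise-≡ (localEdge≤A i j)
      (sumFin-≡⇒pointwise-≡ (sumFin-localEdge≤deg i) (trans (sumFin²-localEdge i) eq) j) w

  closedNbhd : Fin v → Subset v
  closedNbhd i = tabulate (λ w → does (i ≟ w) ∨ adj G i w)

  ∈closedNbhd⁻ : ∀ {i w} → w ∈ closedNbhd i → i ≡ w ⊎ adj G i w ≡ true
  ∈closedNbhd⁻ {i} {w} w∈ with i ≟ w | trans (≡.sym (lookup∘tabulate _ w)) ([]=⇒lookup w∈)
  ... | yes i≡w | _   = inj₁ i≡w
  ... | no _    | i~w = inj₂ i~w

  ∈closedNbhd⁺ : ∀ {i w} → i ≡ w ⊎ adj G i w ≡ true → w ∈ closedNbhd i
  ∈closedNbhd⁺ {i} {w} i≡w⊎i~w = lookup⇒[]= w _ (trans (lookup∘tabulate _ w) (member i≡w⊎i~w))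
    where
    member : i ≡ w ⊎ adj G i w ≡ true → does (i ≟ w) ∨ adj G i w ≡ true
    member (inj₁ refl) = cong (_∨ adj G i i) (dec-true (i ≟ i) refl)
    member (inj₂ i~w)  = trans (cong (does (i ≟ w) ∨_) i~w) (∨-zeroʳ (does (i ≟ w)))

  ∣closedNbhd∣ : ∀ i → ∣ closedNbhd i ∣ ≡ suc (deg i)
  ∣closedNbhd∣ i = begin
    ∣ closedNbhd i ∣                              ≡⟨ ∣tabulate∣ (λ w → does (i ≟ w) ∨ adj G i w) ⟩
    sumFin (λ w → b2n (does (i ≟ w) ∨ adj G i w)) ≡⟨ sumFin-cong indicator ⟩
    sumFin (λ w → δ i w + A i w)                  ≡⟨ sumFin-distrib-+ (δ i) (A i) ⟩
    sumFin (δ i) + deg i                          ≡⟨ cong (_+ deg i) (sumFin-δ i) ⟩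
    suc (deg i)                                   ∎
    where
    open ≡-Reasoning
    indicator : ∀ w → b2n (does (i ≟ w) ∨ adj G i w) ≡ δ i w + A i w
    indicator w with i ≟ w
    ... | yes refl rewrite irrefl G i = refl
    ... | no _     = refl

  closedNbhd-clique : ∀ {i j w} → tAt i + deg i ≡ deg i * deg i →
                      j ∈ closedNbhd i → w ∈ closedNbhd i → j ≢ w → adj G j w ≡ true
  closedNbhd-clique tight j∈ w∈ j≢w with ∈closedNbhd⁻ j∈ | ∈closedNbhd⁻ w∈
  ... | inj₁ refl | inj₁ refl = contradiction refl j≢w
  ... | inj₁ refl | inj₂ i~w  = i~w
  ... | inj₂ i~j  | inj₁ refl = adj-sym i~j
  ... | inj₂ i~j  | inj₂ i~w  = tAt+deg≡deg*deg⇒adj tight i~j i~w j≢w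

  closedNbhd-covers : ∀ {i j w} → tAt i + deg i + deg i ≡ sumFin deg →
                      adj G j w ≡ true → j ∈ closedNbhd i
  closedNbhd-covers {i} {j} {w} tight j~w with i ≟ j | i ≟ w
  ... | yes i≡j | _        = ∈closedNbhd⁺ (inj₁ i≡j)
  ... | no _    | yes refl = ∈closedNbhd⁺ (inj₂ (adj-sym j~w))
  ... | no i≢j  | no i≢w   =
    ∈closedNbhd⁺ (inj₂ (tAt+deg+deg≡sumFin-deg⇒adj tight j~w i≢j i≢w))

  sumFin-c*deg≡2*[c*numEdges] : ∀ c → sumFin (λ i → c * deg i) ≡ 2 * (c * numEdges G)
  sumFin-c*deg≡2*[c*numEdges] c = begin
    sumFin (λ i → c * deg i) ≡⟨ sumFin-*ˡ c deg ⟩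
    c * sumFin deg           ≡⟨ cong (c *_) handshake ⟨
    c * (2 * numEdges G)     ≡⟨ x∙yz≈y∙xz c 2 (numEdges G) ⟩
    2 * (c * numEdges G)     ∎
    where open ≡-Reasoning

  sumT≤ : ∀ c → (∀ i → tAt i ≤ c * deg i) → sumT G ≤ c * numEdges G
  sumT≤ c tAt≤ = *-cancelˡ-≤ 2 (begin
    2 * sumT G               ≡⟨ sumT-double ⟩
    sumFin tAt               ≤⟨ sumFin-mono-≤ tAt≤ ⟩
    sumFin (λ i → c * deg i) ≡⟨ sumFin-c*deg≡2*[c*numEdges] c ⟩
    2 * (c * numEdges G)     ∎)
    where open ≤-Reasoning

  sumT≡⇒tAt≡ : ∀ c → (∀ i → tAt i ≤ c * deg i) → sumT G ≡ c * numEdges G →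
               ∀ i → tAt i ≡ c * deg i
  sumT≡⇒tAt≡ c tAt≤ eq = sumFin-≡⇒pointwise-≡ tAt≤ (begin
    sumFin tAt               ≡⟨ sumT-double ⟨
    2 * sumT G               ≡⟨ cong (2 *_) eq ⟩
    2 * (c * numEdges G)     ≡⟨ sumFin-c*deg≡2*[c*numEdges] c ⟨
    sumFin (λ i → c * deg i) ∎)
    where open ≡-Reasoning

  positive-degree : 1 ≤ numEdges G → ∃ λ i → 0 < deg i
  positive-degree m≥1 = sumFin-positive deg
    (subst (0 <_) handshake (≤-trans m≥1 (m≤m+n (numEdges G) _)))

theorem2 : (n : ℕ) → 3 ≤ n → (v : ℕ) → (G : SimpleGraph v) →
  1 ≤ numEdges G → 2 * numEdges G ≤ n * (n ∸ 1) →
  (sumT G ≤ (n ∸ 2) * numEdges G)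
  × (sumT G ≡ (n ∸ 2) * numEdges G →
      Σ (Subset v) λ S → ∣ S ∣ ≡ n
        × (∀ i j → i ∈ S → j ∈ S → i ≢ j → adj G i j ≡ true)
        × (∀ i j → adj G i j ≡ true → i ∈ S × j ∈ S))
theorem2 zero          ()
theorem2 (suc zero)    (s≤s ())
theorem2 (suc (suc c)) _ v G m≥1 2m≤n[n-1] = sumT≤ G c tAt≤ , λ sumT≡ →
  let i , deg>0 = positive-degree G m≥1
      deg≡n-1 , tight₁ , tight₂ = localBound-tight c (sumT≡⇒tAt≡ G c tAt≤ sumT≡ i) deg>0
                                    (tAt+deg≤deg*deg G i) (tAt+deg+deg≤sumFin-deg G i) sumFin-deg≤
  in closedNbhd G i
   , trans (∣closedNbhd∣ G i) (cong suc deg≡n-1)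
   , (λ _ _ → closedNbhd-clique G tight₁)
   , λ j w j~w → closedNbhd-covers G tight₂ j~w , closedNbhd-covers G tight₂ (adj-sym G j~w)
  where
  sumFin-deg≤ : sumFin (deg G) ≤ suc (suc c) * suc c
  sumFin-deg≤ = subst (_≤ suc (suc c) * suc c) (handshake G) 2m≤n[n-1]
  tAt≤ : ∀ i → tAt G i ≤ c * deg G i
  tAt≤ i = localBound c (tAt+deg≤deg*deg G i) (tAt+deg+deg≤sumFin-deg G i) sumFin-deg≤
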